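{- Let $S$ be a resource monad whose tensor product is symmetric, i.e. $S$ sends a category to its free symmetric strict monoidal, free semicartesian strict monoidal, free relevant strict monoidal, or free cartesian strict monoidal completion. Then for all small categories $A,B$ there is an equivalence of categories $S(A\sqcup B)\simeq SA\times SB$.
   Context: $A\sqcup B$ denotes the coproduct (disjoint union) of categories. The resource monads are the 2-monads on the 2-category of locally small categories sending a category $A$ to, respectively, its free strict monoidal, free symmetric strict monoidal, free semicartesian strict monoidal (symmetric monoidal with terminal unit), free relevant strict monoidal (symmetric monoidal with coherent diagonals $a\to a\otimes a$), or free cartesian strict monoidal completion. -}

module Defs where

open import Level using (Level; _⊔_; Lift; lift) renaming (suc to lsuc)
open import Data.Empty using (⊥)
open import Data.Unit using (⊤; tt)
open import Data.Sum using (_⊎_; inj₁; inj₂)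
open import Data.Product using (Σ; _×_; _,_; proj₁; proj₂)
open import Data.Fin using (Fin)
open import Data.List using (List; length; lookup)
open import Function using (_∘′_) renaming (id to idf)
open import Function.Definitions using (Injective; Surjective; Bijective)
import Function.Construct.Composition as Comp
import Function.Construct.Identity as Ident
open import Relation.Binary.Core using (Rel)
open import Relation.Binary.Structures using (IsEquivalence)
open import Relation.Binary.PropositionalEquality as Eq using (_≡_; refl; cong)

record Category (o ℓ e : Level) : Set (lsuc (o ⊔ ℓ ⊔ e)) where
  infixr 9 _∘_
  infix  4 _≈_
  field
    Obj       : Set o
    _⇒_       : Obj → Obj → Set ℓ
    _≈_       : ∀ {A B} → Rel (A ⇒ B) e
    id        : ∀ {A} → A ⇒ A
    _∘_       : ∀ {A B C} → B ⇒ C → A ⇒ B → A ⇒ C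
    assoc     : ∀ {A B C D} {f : A ⇒ B} {g : B ⇒ C} {h : C ⇒ D} →
                (h ∘ g) ∘ f ≈ h ∘ (g ∘ f)
    identityˡ : ∀ {A B} {f : A ⇒ B} → id ∘ f ≈ f
    identityʳ : ∀ {A B} {f : A ⇒ B} → f ∘ id ≈ f
    equiv     : ∀ {A B} → IsEquivalence (_≈_ {A} {B})
    ∘-resp-≈  : ∀ {A B C} {f h : B ⇒ C} {g i : A ⇒ B} →
                f ≈ h → g ≈ i → f ∘ g ≈ h ∘ i

  module Equiv {A B : Obj} = IsEquivalence (equiv {A} {B})

record Functor {o ℓ e o′ ℓ′ e′} (C : Category o ℓ e) (D : Category o′ ℓ′ e′)
       : Set (o ⊔ ℓ ⊔ e ⊔ o′ ⊔ ℓ′ ⊔ e′) where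
  private
    module C = Category C
    module D = Category D
  field
    F₀           : C.Obj → D.Obj
    F₁           : ∀ {A B} → A C.⇒ B → F₀ A D.⇒ F₀ B
    identity     : ∀ {A} → F₁ (C.id {A}) D.≈ D.id
    homomorphism : ∀ {X Y Z} {f : X C.⇒ Y} {g : Y C.⇒ Z} →
                   F₁ (g C.∘ f) D.≈ F₁ g D.∘ F₁ f
    F-resp-≈     : ∀ {A B} {f g : A C.⇒ B} → f C.≈ g → F₁ f D.≈ F₁ g

idF : ∀ {o ℓ e} {C : Category o ℓ e} → Functor C C
idF {C = C} = record
  { F₀ = idf ; F₁ = idf ; identity = Equiv.refl
  ; homomorphism = Equiv.refl ; F-resp-≈ = idf }
  where open Category C

_∘F_ : ∀ {o ℓ e o′ ℓ′ e′ o″ ℓ″ e″}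
         {C : Category o ℓ e} {D : Category o′ ℓ′ e′} {E : Category o″ ℓ″ e″} →
       Functor D E → Functor C D → Functor C E
_∘F_ {C = C} {D} {E} G F = record
  { F₀ = λ X → G.F₀ (F.F₀ X)
  ; F₁ = λ f → G.F₁ (F.F₁ f)
  ; identity = E.Equiv.trans (G.F-resp-≈ F.identity) G.identity
  ; homomorphism = E.Equiv.trans (G.F-resp-≈ F.homomorphism) G.homomorphism
  ; F-resp-≈ = λ p → G.F-resp-≈ (F.F-resp-≈ p)
  }
  where
    module E = Category E
    module F = Functor F
    module G = Functor G

record NaturalIsomorphism {o ℓ e o′ ℓ′ e′}
       {C : Category o ℓ e} {D : Category o′ ℓ′ e′} (F G : Functor C D)
       : Set (o ⊔ ℓ ⊔ e ⊔ o′ ⊔ ℓ′ ⊔ e′) where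
  private
    module C = Category C
    module D = Category D
    module F = Functor F
    module G = Functor G
  field
    η       : ∀ X → F.F₀ X D.⇒ G.F₀ X
    η⁻¹     : ∀ X → G.F₀ X D.⇒ F.F₀ X
    isoˡ    : ∀ X → η⁻¹ X D.∘ η X D.≈ D.id
    isoʳ    : ∀ X → η X D.∘ η⁻¹ X D.≈ D.id
    commute : ∀ {X Y} (f : X C.⇒ Y) → η Y D.∘ F.F₁ f D.≈ G.F₁ f D.∘ η X

record Equivalence {o ℓ e o′ ℓ′ e′}
       (C : Category o ℓ e) (D : Category o′ ℓ′ e′)
       : Set (o ⊔ ℓ ⊔ e ⊔ o′ ⊔ ℓ′ ⊔ e′) where
  field
    F      : Functor C D
    G      : Functor D C
    unit   : NaturalIsomorphism (idF {C = C}) (G ∘F F)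
    counit : NaturalIsomorphism (F ∘F G) (idF {C = D})

_×C_ : ∀ {o ℓ e o′ ℓ′ e′} → Category o ℓ e → Category o′ ℓ′ e′ →
       Category (o ⊔ o′) (ℓ ⊔ ℓ′) (e ⊔ e′)
C ×C D = record
  { Obj = C.Obj × D.Obj
  ; _⇒_ = λ X Y → (proj₁ X C.⇒ proj₁ Y) × (proj₂ X D.⇒ proj₂ Y)
  ; _≈_ = λ f g → (proj₁ f C.≈ proj₁ g) × (proj₂ f D.≈ proj₂ g)
  ; id = C.id , D.id
  ; _∘_ = λ g f → (proj₁ g C.∘ proj₁ f) , (proj₂ g D.∘ proj₂ f)
  ; assoc = C.assoc , D.assoc
  ; identityˡ = C.identityˡ , D.identityˡ
  ; identityʳ = C.identityʳ , D.identityʳ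
  ; equiv = record
    { refl = C.Equiv.refl , D.Equiv.refl
    ; sym = λ p → C.Equiv.sym (proj₁ p) , D.Equiv.sym (proj₂ p)
    ; trans = λ p q → C.Equiv.trans (proj₁ p) (proj₁ q) , D.Equiv.trans (proj₂ p) (proj₂ q) }
  ; ∘-resp-≈ = λ p q → C.∘-resp-≈ (proj₁ p) (proj₁ q) , D.∘-resp-≈ (proj₂ p) (proj₂ q)
  }
  where
    module C = Category C
    module D = Category D

module _ {o ℓ e} (A B : Category o ℓ e) where
  private
    module A = Category A
    module B = Category B

  CoHom : A.Obj ⊎ B.Obj → A.Obj ⊎ B.Obj → Set ℓ
  CoHom (inj₁ a) (inj₁ a′) = a A.⇒ a′
  CoHom (inj₂ b) (inj₂ b′) = b B.⇒ b′
  CoHom _        _         = Lift ℓ ⊥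

  CoEq : ∀ X Y → Rel (CoHom X Y) e
  CoEq (inj₁ a) (inj₁ a′) = A._≈_
  CoEq (inj₂ b) (inj₂ b′) = B._≈_
  CoEq (inj₁ a) (inj₂ b′) = λ _ _ → Lift e ⊤
  CoEq (inj₂ b) (inj₁ a′) = λ _ _ → Lift e ⊤

  CoId : ∀ X → CoHom X X
  CoId (inj₁ a) = A.id
  CoId (inj₂ b) = B.id

  CoComp : ∀ X Y Z → CoHom Y Z → CoHom X Y → CoHom X Z
  CoComp (inj₁ a) (inj₁ b) (inj₁ c) g f = g A.∘ f
  CoComp (inj₂ a) (inj₂ b) (inj₂ c) g f = g B.∘ f
  CoComp (inj₁ a) (inj₂ b) _ g (lift ())
  CoComp (inj₂ a) (inj₁ b) _ g (lift ())
  CoComp (inj₁ a) (inj₁ b) (inj₂ c) (lift ()) f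
  CoComp (inj₂ a) (inj₂ b) (inj₁ c) (lift ()) f

  infixr 6 _⊔C_
  _⊔C_ : Category o ℓ e
  _⊔C_ = record
    { Obj = A.Obj ⊎ B.Obj
    ; _⇒_ = CoHom
    ; _≈_ = λ {X} {Y} → CoEq X Y
    ; id = λ {X} → CoId X
    ; _∘_ = λ {X} {Y} {Z} → CoComp X Y Z
    ; assoc = λ {X} {Y} {Z} {W} {f} {g} {h} → assoc′ X Y Z W f g h
    ; identityˡ = λ {X} {Y} {f} → idl X Y f
    ; identityʳ = λ {X} {Y} {f} → idr X Y f
    ; equiv = λ {X} {Y} → eqv X Y
    ; ∘-resp-≈ = λ {X} {Y} {Z} {f} {h} {g} {i} → resp X Y Z f h g i
    }
    where
      assoc′ : ∀ X Y Z W (f : CoHom X Y) (g : CoHom Y Z) (h : CoHom Z W) →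
               CoEq X W (CoComp X Y W (CoComp Y Z W h g) f)
                        (CoComp X Z W h (CoComp X Y Z g f))
      assoc′ (inj₁ a) (inj₁ b) (inj₁ c) (inj₁ d) f g h = A.assoc
      assoc′ (inj₂ a) (inj₂ b) (inj₂ c) (inj₂ d) f g h = B.assoc
      assoc′ (inj₁ a) (inj₂ b) _ _ (lift ()) g h
      assoc′ (inj₂ a) (inj₁ b) _ _ (lift ()) g h
      assoc′ (inj₁ a) (inj₁ b) (inj₂ c) _ f (lift ()) h
      assoc′ (inj₂ a) (inj₂ b) (inj₁ c) _ f (lift ()) h
      assoc′ (inj₁ a) (inj₁ b) (inj₁ c) (inj₂ d) f g (lift ())
      assoc′ (inj₂ a) (inj₂ b) (inj₂ c) (inj₁ d) f g (lift ())

      idl : ∀ X Y (f : CoHom X Y) → CoEq X Y (CoComp X Y Y (CoId Y) f) f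
      idl (inj₁ a) (inj₁ b) f = A.identityˡ
      idl (inj₂ a) (inj₂ b) f = B.identityˡ
      idl (inj₁ a) (inj₂ b) (lift ())
      idl (inj₂ a) (inj₁ b) (lift ())

      idr : ∀ X Y (f : CoHom X Y) → CoEq X Y (CoComp X X Y f (CoId X)) f
      idr (inj₁ a) (inj₁ b) f = A.identityʳ
      idr (inj₂ a) (inj₂ b) f = B.identityʳ
      idr (inj₁ a) (inj₂ b) (lift ())
      idr (inj₂ a) (inj₁ b) (lift ())

      eqv : ∀ X Y → IsEquivalence (CoEq X Y)
      eqv (inj₁ a) (inj₁ b) = A.equiv
      eqv (inj₂ a) (inj₂ b) = B.equiv
      eqv (inj₁ a) (inj₂ b) = record { refl = lift tt ; sym = λ _ → lift tt ; trans = λ _ _ → lift tt }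
      eqv (inj₂ a) (inj₁ b) = record { refl = lift tt ; sym = λ _ → lift tt ; trans = λ _ _ → lift tt }

      resp : ∀ X Y Z (f h : CoHom Y Z) (g i : CoHom X Y) →
             CoEq Y Z f h → CoEq X Y g i →
             CoEq X Z (CoComp X Y Z f g) (CoComp X Y Z h i)
      resp (inj₁ a) (inj₁ b) (inj₁ c) f h g i p q = A.∘-resp-≈ p q
      resp (inj₂ a) (inj₂ b) (inj₂ c) f h g i p q = B.∘-resp-≈ p q
      resp (inj₁ a) (inj₂ b) _ f h (lift ()) i p q
      resp (inj₂ a) (inj₁ b) _ f h (lift ()) i p q
      resp (inj₁ a) (inj₁ b) (inj₂ c) (lift ()) h g i p q
      resp (inj₂ a) (inj₂ b) (inj₁ c) (lift ()) h g i p q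

-- The symmetric resource monads, via their standard explicit presentation.
--
-- For a category C, S k C has as objects finite lists [c₀,…,cₙ₋₁] of
-- objects of C; a morphism [a₀,…,aₙ₋₁] → [b₀,…,bₘ₋₁] is a function
-- φ : Fin m → Fin n of the kind allowed by k together with morphisms
-- fⱼ : a_{φ j} → b_j in C.  The allowed φ are
--   symmetric     : bijections   (free symmetric strict monoidal)
--   semicartesian : injections   (free semicartesian strict monoidal)
--   relevant      : surjections  (free relevant strict monoidal)
--   cartesian     : all maps     (free cartesian strict monoidal)

data Kind : Set where
  symmetric semicartesian relevant cartesian : Kind

Admissible : Kind → ∀ {m n} → (Fin m → Fin n) → Set
Admissible symmetric     φ = Bijective _≡_ _≡_ φ
Admissible semicartesian φ = Injective _≡_ _≡_ φ
Admissible relevant      φ = Surjective _≡_ _≡_ φ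
Admissible cartesian     φ = ⊤

admissible-id : ∀ k {n} → Admissible k (idf {A = Fin n})
admissible-id symmetric     = Ident.bijective _≡_
admissible-id semicartesian = Ident.injective _≡_
admissible-id relevant      = Ident.surjective _≡_
admissible-id cartesian     = tt

admissible-∘ : ∀ k {l m n} {φ : Fin m → Fin n} {ψ : Fin l → Fin m} →
               Admissible k φ → Admissible k ψ → Admissible k (φ ∘′ ψ)
admissible-∘ symmetric     p q = Comp.bijective _≡_ _≡_ _≡_ q p
admissible-∘ semicartesian p q = Comp.injective _≡_ _≡_ _≡_ q p
admissible-∘ relevant      p q = Comp.surjective _≡_ _≡_ _≡_ q p
admissible-∘ cartesian     p q = tt

module _ (k : Kind) {o ℓ e} (C : Category o ℓ e) where
  private
    module C = Category C
  open C using (Obj; _⇒_; _≈_)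

  record SHom (xs ys : List Obj) : Set ℓ where
    constructor shom
    field
      map  : Fin (length ys) → Fin (length xs)
      adm  : Admissible k map
      comp : ∀ j → lookup xs (map j) ⇒ lookup ys j
  open SHom

  EqAt : ∀ (xs : List Obj) {y : Obj} {i i′ : Fin (length xs)} → i ≡ i′ →
         lookup xs i ⇒ y → lookup xs i′ ⇒ y → Set e
  EqAt xs refl u v = u ≈ v

  SEq : ∀ {xs ys} → Rel (SHom xs ys) e
  SEq {xs} f g = ∀ j → Σ (map f j ≡ map g j) λ p → EqAt xs p (comp f j) (comp g j)

  private
    eqSym : ∀ xs {y} {i i′ : Fin (length xs)} (p : i ≡ i′) {u v} →
            EqAt xs {y} p u v → EqAt xs (Eq.sym p) v u
    eqSym xs refl q = C.Equiv.sym q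

    eqTrans : ∀ xs {y} {i i′ i″ : Fin (length xs)} (p : i ≡ i′) (p′ : i′ ≡ i″)
              {u v w} → EqAt xs {y} p u v → EqAt xs p′ v w → EqAt xs (Eq.trans p p′) u w
    eqTrans xs refl refl q q′ = C.Equiv.trans q q′

    eqPost : ∀ xs {y z} {i i′ : Fin (length xs)} (p : i ≡ i′)
             {u u′ : y ⇒ z} {v v′} → u ≈ u′ → EqAt xs {y} p v v′ →
             EqAt xs p (u C.∘ v) (u′ C.∘ v′)
    eqPost xs refl q r = C.∘-resp-≈ q r

  _∘S_ : ∀ {xs ys zs} → SHom ys zs → SHom xs ys → SHom xs zs
  g ∘S f = shom (map f ∘′ map g) (admissible-∘ k (adm f) (adm g))
                (λ j → comp g j C.∘ comp f (map g j))

  idS : ∀ {xs} → SHom xs xs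
  idS = shom idf (admissible-id k) (λ j → C.id)

  private
    respS : ∀ {xs ys zs} (f f′ : SHom xs ys) (g g′ : SHom ys zs) →
            SEq g g′ → SEq f f′ → SEq (g ∘S f) (g′ ∘S f′)
    respS {xs} {ys} {zs} f f′ g g′ h k′ j = helper (proj₁ (h j)) (proj₂ (h j))
      where
        helper : ∀ {i i′ : Fin (length ys)} (p : i ≡ i′)
                 {u : lookup ys i ⇒ lookup zs j} {u′ : lookup ys i′ ⇒ lookup zs j} →
                 EqAt ys p u u′ →
                 Σ (map f i ≡ map f′ i′) λ r →
                   EqAt xs r (u C.∘ comp f i) (u′ C.∘ comp f′ i′)
        helper {i} refl q = proj₁ (k′ i) , eqPost xs (proj₁ (k′ i)) q (proj₂ (k′ i))

  S : Category o ℓ e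
  S = record
    { Obj = List Obj
    ; _⇒_ = SHom
    ; _≈_ = SEq
    ; id = idS
    ; _∘_ = _∘S_
    ; assoc = λ j → refl , C.assoc
    ; identityˡ = λ j → refl , C.identityˡ
    ; identityʳ = λ j → refl , C.identityʳ
    ; equiv = λ {xs} {ys} → record
      { refl = λ j → refl , C.Equiv.refl
      ; sym = λ {_} {_} p j → Eq.sym (proj₁ (p j)) , eqSym xs (proj₁ (p j)) (proj₂ (p j))
      ; trans = λ {_} {_} {_} p q j → Eq.trans (proj₁ (p j)) (proj₁ (q j))
                        , eqTrans xs (proj₁ (p j)) (proj₁ (q j)) (proj₂ (p j)) (proj₂ (q j))
      }
    ; ∘-resp-≈ = λ {_} {_} {_} {g} {g′} {f} {f′} → respS f f′ g g′
    }

module Submission where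

-- An arrow of S(A ⊔ B) is an admissible reindexing of positions together with
-- componentwise arrows of A ⊔ B.  Since A ⊔ B has no arrows between its two
-- summands, once the positions of source and target are sorted by summand (a
-- Decomposition), the reindexing sends A-positions to A-positions and
-- B-positions to B-positions.  It is therefore the sum of two reindexings,
-- which are admissible because a sum of maps is bijective, injective or
-- surjective exactly when both summands are.  So `join`, which assembles an
-- arrow of SA and one of SB along decompositions, is full and faithful.  Every
-- list decomposes (partitionSums) and every pair of lists is realised (all
-- A-objects first), and a fully faithful anafunctor that is surjective on
-- objects in this sense is an equivalence.

open import Defs
open import Level using (_⊔_; lift) renaming (suc to lsuc)
open import Data.Unit using (⊤; tt)
open import Data.Sum as Sum using (_⊎_; inj₁; inj₂)
open import Data.Sum.Properties using (inj₁-injective; inj₂-injective)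
open import Data.Sum.Function.Setoid using (⊎-injective; ⊎-surjective)
open import Data.Sum.Relation.Binary.Pointwise using (Pointwise-≡⇒≡; ≡⇒Pointwise-≡)
open import Data.Product using (Σ; _×_; _,_; proj₁; proj₂)
open import Data.Fin using (Fin; zero; suc)
open import Data.List as List using (List; []; _∷_; _++_; length; lookup; partitionSums)
open import Function using (_∘′_)
open import Function.Definitions
  using (Injective; Surjective; Bijective; StrictlyInverseˡ; StrictlyInverseʳ)
open import Function.Consequences.Propositional
  using ( inverseʳ⇒injective; inverseᵇ⇒bijective
        ; strictlyInverseˡ⇒inverseˡ; strictlyInverseʳ⇒inverseʳ)
import Function.Construct.Composition as Comp
open import Relation.Binary.Bundles using (Setoid)
import Relation.Binary.Reasoning.Setoid as SetoidReasoning
open import Relation.Binary.PropositionalEquality as ≡ using (_≡_; _≗_; refl; cong)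

hom-setoid : ∀ {o ℓ e} (C : Category o ℓ e) (X Y : Category.Obj C) → Setoid ℓ e
hom-setoid C X Y = record { Carrier = X ⇒ Y ; _≈_ = _≈_ ; isEquivalence = equiv }
  where open Category C

module HomReasoning {o ℓ e} (C : Category o ℓ e) {X Y : Category.Obj C} =
  SetoidReasoning (hom-setoid C X Y)

module HeterogeneousHom {o ℓ e} (C : Category o ℓ e) where
  open Category C

  infix 4 _≋_ _≋[_,_]_

  data _≋_ {X Y : Obj} (u : X ⇒ Y) : ∀ {X′ Y′} → X′ ⇒ Y′ → Set (o ⊔ ℓ ⊔ e) where
    ≈⇒≋ : ∀ {v : X ⇒ Y} → u ≈ v → u ≋ v

  -- Where hom-sets compute by cases on the objects (as in A ⊔C B), Agda cannot
  -- infer the endpoints of an arrow from its type; this form names them.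
  _≋[_,_]_ : ∀ {X Y} → X ⇒ Y → ∀ X′ Y′ → X′ ⇒ Y′ → Set (o ⊔ ℓ ⊔ e)
  u ≋[ X′ , Y′ ] v = u ≋ v

  ≋-refl : ∀ {X Y} {u : X ⇒ Y} → u ≋ u
  ≋-refl = ≈⇒≋ Equiv.refl

  ≋-sym : ∀ {X Y X′ Y′} {u : X ⇒ Y} {v : X′ ⇒ Y′} → u ≋ v → v ≋ u
  ≋-sym (≈⇒≋ p) = ≈⇒≋ (Equiv.sym p)

  ≋-trans : ∀ {X Y X′ Y′ X″ Y″} {u : X ⇒ Y} {v : X′ ⇒ Y′} {w : X″ ⇒ Y″} →
            u ≋ v → v ≋ w → u ≋ w
  ≋-trans (≈⇒≋ p) (≈⇒≋ q) = ≈⇒≋ (Equiv.trans p q)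

  ∘-resp-≋ : ∀ {X Y Z X′ Y′ Z′} {u : Y ⇒ Z} {v : X ⇒ Y}
               {u′ : Y′ ⇒ Z′} {v′ : X′ ⇒ Y′} →
             u ≋ u′ → v ≋ v′ → u ∘ v ≋ u′ ∘ v′
  ∘-resp-≋ (≈⇒≋ p) (≈⇒≋ q) = ≈⇒≋ (∘-resp-≈ p q)

  ≋-cong : ∀ {I : Set} {F G : I → Obj} (u : ∀ i → F i ⇒ G i) {i j} → i ≡ j → u i ≋ u j
  ≋-cong u refl = ≋-refl

  id-≋ : ∀ {X Y} → X ≡ Y → id {X} ≋ id {Y}
  id-≋ refl = ≋-refl

  transport : ∀ {X Y} → X ≡ Y → X ⇒ Y
  transport refl = id

  transport-∘-≋ : ∀ {X Y Z} (p : Y ≡ Z) (u : X ⇒ Y) → transport p ∘ u ≋ u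
  transport-∘-≋ refl u = ≈⇒≋ identityˡ

  ∘-transport-≋ : ∀ {X Y Z} (u : Y ⇒ Z) (p : X ≡ Y) → u ∘ transport p ≋ u
  ∘-transport-≋ u refl = ≈⇒≋ identityʳ

  conjugate : ∀ {W X Y Z} → Y ≡ Z → X ⇒ Y → W ≡ X → W ⇒ Z
  conjugate p u q = transport p ∘ u ∘ transport q

  conjugate-≋ : ∀ {W X Y Z} (p : Y ≡ Z) (u : X ⇒ Y) (q : W ≡ X) → conjugate p u q ≋ u
  conjugate-≋ p u q = ≋-trans (transport-∘-≋ p (u ∘ transport q)) (∘-transport-≋ u q)

module _ (k : Kind) {o ℓ e} (C : Category o ℓ e) where
  open HeterogeneousHom C
  open SHom

  private
    ≋⇒EqAt : ∀ xs {y} {i i′} (p : i ≡ i′) {u v} → u ≋ v → EqAt k C xs {y} p u v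
    ≋⇒EqAt xs refl (≈⇒≋ q) = q

    EqAt⇒≋ : ∀ xs {y} {i i′} (p : i ≡ i′) {u v} → EqAt k C xs {y} p u v → u ≋ v
    EqAt⇒≋ xs refl q = ≈⇒≋ q

  pointwise⇒SEq : ∀ {xs ys} {f g : SHom k C xs ys} →
                  (∀ j → map f j ≡ map g j × comp f j ≋ comp g j) → SEq k C f g
  pointwise⇒SEq {xs} eq j = proj₁ (eq j) , ≋⇒EqAt xs (proj₁ (eq j)) (proj₂ (eq j))

  SEq⇒≋ : ∀ {xs ys} {f g : SHom k C xs ys} → SEq k C f g → ∀ j → comp f j ≋ comp g j
  SEq⇒≋ {xs} eq j = EqAt⇒≋ xs (proj₁ (eq j)) (proj₂ (eq j))

Admissible′ : Kind → {I J : Set} → (I → J) → Set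
Admissible′ symmetric     φ = Bijective _≡_ _≡_ φ
Admissible′ semicartesian φ = Injective _≡_ _≡_ φ
Admissible′ relevant      φ = Surjective _≡_ _≡_ φ
Admissible′ cartesian     φ = ⊤

admissible⇒admissible′ : ∀ k {m n} {φ : Fin m → Fin n} → Admissible k φ → Admissible′ k φ
admissible⇒admissible′ symmetric     p = p
admissible⇒admissible′ semicartesian p = p
admissible⇒admissible′ relevant      p = p
admissible⇒admissible′ cartesian     p = p

admissible′⇒admissible : ∀ k {m n} {φ : Fin m → Fin n} → Admissible′ k φ → Admissible k φ
admissible′⇒admissible symmetric     p = p
admissible′⇒admissible semicartesian p = p
admissible′⇒admissible relevant      p = p
admissible′⇒admissible cartesian     p = p

private
  variable
    I J K L : Set

admissible′-∘ : ∀ k {φ : J → K} {ψ : I → J} →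
                Admissible′ k φ → Admissible′ k ψ → Admissible′ k (φ ∘′ ψ)
admissible′-∘ symmetric     p q = Comp.bijective _≡_ _≡_ _≡_ q p
admissible′-∘ semicartesian p q = Comp.injective _≡_ _≡_ _≡_ q p
admissible′-∘ relevant      p q = Comp.surjective _≡_ _≡_ _≡_ q p
admissible′-∘ cartesian     p q = tt

bijective⇒admissible′ : ∀ k {φ : I → J} → Bijective _≡_ _≡_ φ → Admissible′ k φ
bijective⇒admissible′ symmetric     b = b
bijective⇒admissible′ semicartesian b = proj₁ b
bijective⇒admissible′ relevant      b = proj₂ b
bijective⇒admissible′ cartesian     b = tt

admissible′-conjugate : ∀ k {β : K → L} {φ : J → K} {γ : I → J} →
                        Bijective _≡_ _≡_ β → Bijective _≡_ _≡_ γ →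
                        Admissible′ k φ → Admissible′ k (β ∘′ φ ∘′ γ)
admissible′-conjugate k β-bij γ-bij φ-adm =
  admissible′-∘ k (bijective⇒admissible′ k β-bij)
                  (admissible′-∘ k φ-adm (bijective⇒admissible′ k γ-bij))

admissible′-resp-≗ : ∀ k {φ ψ : I → J} → φ ≗ ψ → Admissible′ k φ → Admissible′ k ψ
admissible′-resp-≗ k {φ} {ψ} φ≗ψ = go k
  where
    injective : Injective _≡_ _≡_ φ → Injective _≡_ _≡_ ψ
    injective inj eq = inj (≡.trans (φ≗ψ _) (≡.trans eq (≡.sym (φ≗ψ _))))
    surjective : Surjective _≡_ _≡_ φ → Surjective _≡_ _≡_ ψ
    surjective surj y =
      proj₁ (surj y) , λ { refl → ≡.trans (≡.sym (φ≗ψ _)) (proj₂ (surj y) refl) }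
    go : ∀ k → Admissible′ k φ → Admissible′ k ψ
    go symmetric     (inj , surj) = injective inj , surjective surj
    go semicartesian inj          = injective inj
    go relevant      surj         = surjective surj
    go cartesian     _            = tt

admissible′-⊎ : ∀ k {φ : I → J} {ψ : K → L} →
                Admissible′ k φ → Admissible′ k ψ → Admissible′ k (Sum.map φ ψ)
admissible′-⊎ k {φ} {ψ} = go k
  where
    injective : Injective _≡_ _≡_ φ → Injective _≡_ _≡_ ψ →
                Injective _≡_ _≡_ (Sum.map φ ψ)
    injective p q eq = Pointwise-≡⇒≡ (⊎-injective p q (≡⇒Pointwise-≡ eq))
    surjective : Surjective _≡_ _≡_ φ → Surjective _≡_ _≡_ ψ →
                 Surjective _≡_ _≡_ (Sum.map φ ψ)
    surjective p q y with ⊎-surjective p q y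
    ... | x , fx≈y = x , λ { refl → Pointwise-≡⇒≡ (fx≈y (≡⇒Pointwise-≡ refl)) }
    go : ∀ k → Admissible′ k φ → Admissible′ k ψ → Admissible′ k (Sum.map φ ψ)
    go symmetric     (i , s) (i′ , s′) = injective i i′ , surjective s s′
    go semicartesian i i′              = injective i i′
    go relevant      s s′              = surjective s s′
    go cartesian     _ _               = tt

admissible′-⊎⁻ : ∀ k {φ : I → J} {ψ : K → L} →
                 Admissible′ k (Sum.map φ ψ) → Admissible′ k φ × Admissible′ k ψ
admissible′-⊎⁻ k {φ} {ψ} = go k
  where
    injective : Injective _≡_ _≡_ (Sum.map φ ψ) → Injective _≡_ _≡_ φ × Injective _≡_ _≡_ ψ
    injective inj = (λ eq → inj₁-injective (inj (cong inj₁ eq)))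
                  , (λ eq → inj₂-injective (inj (cong inj₂ eq)))
    surjectiveˡ : Surjective _≡_ _≡_ (Sum.map φ ψ) → Surjective _≡_ _≡_ φ
    surjectiveˡ surj y with surj (inj₁ y)
    ... | inj₁ x , fx≡y = x , λ { refl → inj₁-injective (fx≡y refl) }
    ... | inj₂ _ , fx≡y with () ← fx≡y refl
    surjectiveʳ : Surjective _≡_ _≡_ (Sum.map φ ψ) → Surjective _≡_ _≡_ ψ
    surjectiveʳ surj y with surj (inj₂ y)
    ... | inj₂ x , fx≡y = x , λ { refl → inj₂-injective (fx≡y refl) }
    ... | inj₁ _ , fx≡y with () ← fx≡y refl
    go : ∀ k → Admissible′ k (Sum.map φ ψ) → Admissible′ k φ × Admissible′ k ψ
    go symmetric     (inj , surj) = (proj₁ (injective inj) , surjectiveˡ surj)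
                                  , (proj₂ (injective inj) , surjectiveʳ surj)
    go semicartesian inj          = injective inj
    go relevant      surj         = surjectiveˡ surj , surjectiveʳ surj
    go cartesian     _            = tt , tt

module Respecification {o ℓ e o′ ℓ′ e′ r} {C : Category o ℓ e} {D : Category o′ ℓ′ e′}
  (R : Category.Obj C → Category.Obj D → Set r)
  (T : ∀ {c c′ d d′} → R c d → R c′ d′ → Category._⇒_ C c c′ → Category._⇒_ D d d′)
  (T-resp-≈ : ∀ {c c′ d d′} (s : R c d) (s′ : R c′ d′) {f g} →
              Category._≈_ C f g → Category._≈_ D (T s s′ f) (T s s′ g))
  (T-identity : ∀ {c d} (s : R c d) → Category._≈_ D (T s s (Category.id C)) (Category.id D))
  (T-homomorphism : ∀ {c c′ c″ d d′ d″} (s : R c d) (s′ : R c′ d′) (s″ : R c″ d″) {f g} →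
                    Category._≈_ D (T s s″ (Category._∘_ C g f))
                                   (Category._∘_ D (T s′ s″ g) (T s s′ f)))
  where
  private
    module C = Category C
    module D = Category D
  open HomReasoning D

  respecify-iso : ∀ {c d d′} (s : R c d) (s′ : R c d′) → T s′ s C.id D.∘ T s s′ C.id D.≈ D.id
  respecify-iso s s′ = begin
    T s′ s C.id D.∘ T s s′ C.id ≈⟨ T-homomorphism s s′ s ⟨
    T s s (C.id C.∘ C.id)       ≈⟨ T-resp-≈ s s C.identityˡ ⟩
    T s s C.id                  ≈⟨ T-identity s ⟩
    D.id                        ∎

  respecify-natural : ∀ {c c′ d₁ d₂ d₁′ d₂′} (s₁ : R c d₁) (s₂ : R c d₂)
                      (t₁ : R c′ d₁′) (t₂ : R c′ d₂′) (f : c C.⇒ c′) →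
                      T t₁ t₂ C.id D.∘ T s₁ t₁ f D.≈ T s₂ t₂ f D.∘ T s₁ s₂ C.id
  respecify-natural s₁ s₂ t₁ t₂ f = begin
    T t₁ t₂ C.id D.∘ T s₁ t₁ f ≈⟨ T-homomorphism s₁ t₁ t₂ ⟨
    T s₁ t₂ (C.id C.∘ f)       ≈⟨ T-resp-≈ s₁ t₂ (C.Equiv.trans C.identityˡ
                                                               (C.Equiv.sym C.identityʳ)) ⟩
    T s₁ t₂ (f C.∘ C.id)       ≈⟨ T-homomorphism s₁ s₂ t₂ ⟩
    T s₂ t₂ f D.∘ T s₁ s₂ C.id ∎

-- `Spec d x` says that x realises d; the action on arrows depends on the
-- chosen realisations, as for Makkai's anafunctors.
record FullyFaithfulAnafunctor {o ℓ e o′ ℓ′ e′} (D : Category o′ ℓ′ e′) (C : Category o ℓ e) r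
       : Set (o ⊔ ℓ ⊔ e ⊔ o′ ⊔ ℓ′ ⊔ e′ ⊔ lsuc r) where
  private
    module C = Category C
    module D = Category D
  field
    Spec         : D.Obj → C.Obj → Set r
    specify      : ∀ x → Σ D.Obj λ d → Spec d x
    realise      : ∀ d → Σ C.Obj (Spec d)
    F₁           : ∀ {d d′ x x′} → Spec d x → Spec d′ x′ → d D.⇒ d′ → x C.⇒ x′
    F-resp-≈     : ∀ {d d′ x x′} (s : Spec d x) (s′ : Spec d′ x′) {f g} →
                   f D.≈ g → F₁ s s′ f C.≈ F₁ s s′ g
    identity     : ∀ {d x} (s : Spec d x) → F₁ s s D.id C.≈ C.id
    homomorphism : ∀ {d d′ d″ x x′ x″}
                     (s : Spec d x) (s′ : Spec d′ x′) (s″ : Spec d″ x″) {f g} →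
                   F₁ s s″ (g D.∘ f) C.≈ F₁ s′ s″ g C.∘ F₁ s s′ f
    faithful     : ∀ {d d′ x x′} (s : Spec d x) (s′ : Spec d′ x′) {f g} →
                   F₁ s s′ f C.≈ F₁ s s′ g → f D.≈ g
    full         : ∀ {d d′ x x′} (s : Spec d x) (s′ : Spec d′ x′) (h : x C.⇒ x′) →
                   Σ (d D.⇒ d′) λ f → F₁ s s′ f C.≈ h

module _ {o ℓ e o′ ℓ′ e′ r} {C : Category o ℓ e} {D : Category o′ ℓ′ e′}
         (Φ : FullyFaithfulAnafunctor D C r) where
  open FullyFaithfulAnafunctor Φ
  private
    module C = Category C
    module D = Category D

    F₁⁻¹ : ∀ {d d′ x x′} → Spec d x → Spec d′ x′ → x C.⇒ x′ → d D.⇒ d′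
    F₁⁻¹ s s′ h = proj₁ (full s s′ h)

    F₁-F₁⁻¹ : ∀ {d d′ x x′} (s : Spec d x) (s′ : Spec d′ x′) (h : x C.⇒ x′) →
              F₁ s s′ (F₁⁻¹ s s′ h) C.≈ h
    F₁-F₁⁻¹ s s′ h = proj₂ (full s s′ h)

    F₁⁻¹-F₁ : ∀ {d d′ x x′} (s : Spec d x) (s′ : Spec d′ x′) (f : d D.⇒ d′) →
              F₁⁻¹ s s′ (F₁ s s′ f) D.≈ f
    F₁⁻¹-F₁ s s′ f = faithful s s′ (F₁-F₁⁻¹ s s′ (F₁ s s′ f))

    F₁⁻¹-resp-≈ : ∀ {d d′ x x′} (s : Spec d x) (s′ : Spec d′ x′) {h h′} →
                  h C.≈ h′ → F₁⁻¹ s s′ h D.≈ F₁⁻¹ s s′ h′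
    F₁⁻¹-resp-≈ s s′ {h} {h′} h≈h′ = faithful s s′ (begin
      F₁ s s′ (F₁⁻¹ s s′ h)  ≈⟨ F₁-F₁⁻¹ s s′ h ⟩
      h                      ≈⟨ h≈h′ ⟩
      h′                     ≈⟨ F₁-F₁⁻¹ s s′ h′ ⟨
      F₁ s s′ (F₁⁻¹ s s′ h′) ∎)
      where open HomReasoning C

    F₁⁻¹-identity : ∀ {d x} (s : Spec d x) → F₁⁻¹ s s C.id D.≈ D.id
    F₁⁻¹-identity s = faithful s s (C.Equiv.trans (F₁-F₁⁻¹ s s C.id) (C.Equiv.sym (identity s)))

    F₁⁻¹-homomorphism : ∀ {d d′ d″ x x′ x″}
                          (s : Spec d x) (s′ : Spec d′ x′) (s″ : Spec d″ x″) {h h′} →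
                        F₁⁻¹ s s″ (h′ C.∘ h) D.≈ F₁⁻¹ s′ s″ h′ D.∘ F₁⁻¹ s s′ h
    F₁⁻¹-homomorphism s s′ s″ {h} {h′} = faithful s s″ (begin
      F₁ s s″ (F₁⁻¹ s s″ (h′ C.∘ h))
        ≈⟨ F₁-F₁⁻¹ s s″ (h′ C.∘ h) ⟩
      h′ C.∘ h
        ≈⟨ C.∘-resp-≈ (F₁-F₁⁻¹ s′ s″ h′) (F₁-F₁⁻¹ s s′ h) ⟨
      F₁ s′ s″ (F₁⁻¹ s′ s″ h′) C.∘ F₁ s s′ (F₁⁻¹ s s′ h)
        ≈⟨ homomorphism s s′ s″ ⟨
      F₁ s s″ (F₁⁻¹ s′ s″ h′ D.∘ F₁⁻¹ s s′ h)
        ∎)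
      where open HomReasoning C

    open Respecification {C = D} {D = C} Spec F₁ F-resp-≈ identity homomorphism
    module Inverse = Respecification {C = C} {D = D} (λ x d → Spec d x)
                       F₁⁻¹ F₁⁻¹-resp-≈ F₁⁻¹-identity F₁⁻¹-homomorphism

    spec : ∀ x → Spec (proj₁ (specify x)) x
    spec x = proj₂ (specify x)

    real : ∀ d → Spec d (proj₁ (realise d))
    real d = proj₂ (realise d)

    Forward : Functor C D
    Forward = record
      { F₀           = λ x → proj₁ (specify x)
      ; F₁           = λ {x} {y} → F₁⁻¹ (spec x) (spec y)
      ; identity     = λ {x} → F₁⁻¹-identity (spec x)
      ; homomorphism = λ {x} {y} {z} → F₁⁻¹-homomorphism (spec x) (spec y) (spec z)
      ; F-resp-≈     = λ {x} {y} → F₁⁻¹-resp-≈ (spec x) (spec y)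
      }

    Backward : Functor D C
    Backward = record
      { F₀           = λ d → proj₁ (realise d)
      ; F₁           = λ {d} {d′} → F₁ (real d) (real d′)
      ; identity     = λ {d} → identity (real d)
      ; homomorphism = λ {d} {d′} {d″} → homomorphism (real d) (real d′) (real d″)
      ; F-resp-≈     = λ {d} {d′} → F-resp-≈ (real d) (real d′)
      }

  FullyFaithfulAnafunctor⇒Equivalence : Equivalence C D
  FullyFaithfulAnafunctor⇒Equivalence = record
    { F      = Forward
    ; G      = Backward
    ; unit   = record
      { η       = λ x → F₁ (spec x) (real _) D.id
      ; η⁻¹     = λ x → F₁ (real _) (spec x) D.id
      ; isoˡ    = λ x → respecify-iso (spec x) (real _)
      ; isoʳ    = λ x → respecify-iso (real _) (spec x)
      ; commute = λ {x} {y} h → C.Equiv.trans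
          (C.∘-resp-≈ C.Equiv.refl (C.Equiv.sym (F₁-F₁⁻¹ (spec x) (spec y) h)))
          (respecify-natural (spec x) (real _) (spec y) (real _) (F₁⁻¹ (spec x) (spec y) h))
      }
    ; counit = record
      { η       = λ d → F₁⁻¹ (spec _) (real d) C.id
      ; η⁻¹     = λ d → F₁⁻¹ (real d) (spec _) C.id
      ; isoˡ    = λ d → Inverse.respecify-iso (spec _) (real d)
      ; isoʳ    = λ d → Inverse.respecify-iso (real d) (spec _)
      ; commute = λ {d} {d′} f → D.Equiv.trans
          (Inverse.respecify-natural (spec _) (real d) (spec _) (real d′) (F₁ (real d) (real d′) f))
          (D.∘-resp-≈ (F₁⁻¹-F₁ (real d) (real d′) f) D.Equiv.refl)
      }
    }

module Coproduct (k : Kind) {o ℓ e} (A B : Category o ℓ e) where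
  private
    C : Category o ℓ e
    C = A ⊔C B
    module A = Category A
    module B = Category B
    module C = Category C
    module SA = Category (S k A)
    module SB = Category (S k B)
    module SC = Category (S k C)
    module A≋ = HeterogeneousHom A
    module B≋ = HeterogeneousHom B
  open HeterogeneousHom C
  open SHom

  Pos : List A.Obj → List B.Obj → Set
  Pos as bs = Fin (length as) ⊎ Fin (length bs)

  lookup⊎ : ∀ as bs → Pos as bs → C.Obj
  lookup⊎ as bs = Sum.map (lookup as) (lookup bs)

  record Decomposition (xs : List C.Obj) (as : List A.Obj) (bs : List B.Obj) : Set o where
    field
      embed          : Pos as bs → Fin (length xs)
      classify       : Fin (length xs) → Pos as bs
      embed-classify : StrictlyInverseˡ _≡_ embed classify
      classify-embed : StrictlyInverseʳ _≡_ embed classify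
      lookup-embed   : ∀ s → lookup xs (embed s) ≡ lookup⊎ as bs s

    embed-injective : Injective _≡_ _≡_ embed
    embed-injective =
      inverseʳ⇒injective embed (strictlyInverseʳ⇒inverseʳ {f⁻¹ = classify} embed classify-embed)

    embed-bijective : Bijective _≡_ _≡_ embed
    embed-bijective = inverseᵇ⇒bijective ( strictlyInverseˡ⇒inverseˡ embed embed-classify
                                          , strictlyInverseʳ⇒inverseʳ embed classify-embed)

    classify-bijective : Bijective _≡_ _≡_ classify
    classify-bijective = inverseᵇ⇒bijective ( strictlyInverseˡ⇒inverseˡ classify classify-embed
                                             , strictlyInverseʳ⇒inverseʳ classify embed-classify)

    lookup-classify : ∀ i → lookup⊎ as bs (classify i) ≡ lookup xs i
    lookup-classify i = ≡.trans (≡.sym (lookup-embed (classify i))) (cong (lookup xs) (embed-classify i))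

    elim : ∀ {p} (P : Fin (length xs) → Set p) → (∀ s → P (embed s)) → ∀ i → P i
    elim P P-embed i = ≡.subst P (embed-classify i) (P-embed (classify i))

  []ᴰ : Decomposition [] [] []
  []ᴰ = record
    { embed          = λ { (inj₁ ()) ; (inj₂ ()) }
    ; classify       = λ ()
    ; embed-classify = λ ()
    ; classify-embed = λ { (inj₁ ()) ; (inj₂ ()) }
    ; lookup-embed   = λ { (inj₁ ()) ; (inj₂ ()) }
    }

  consˡ : ∀ {xs as bs} a → Decomposition xs as bs → Decomposition (inj₁ a ∷ xs) (a ∷ as) bs
  consˡ {xs} {as} {bs} a d = record
    { embed = embed ; classify = classify ; embed-classify = embed-classify
    ; classify-embed = classify-embed ; lookup-embed = lookup-embed }
    where
      module d = Decomposition d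
      embed : Pos (a ∷ as) bs → Fin (length (inj₁ a ∷ xs))
      embed (inj₁ zero)    = zero
      embed (inj₁ (suc i)) = suc (d.embed (inj₁ i))
      embed (inj₂ j)       = suc (d.embed (inj₂ j))
      classify : Fin (length (inj₁ a ∷ xs)) → Pos (a ∷ as) bs
      classify zero    = inj₁ zero
      classify (suc i) = Sum.map₁ suc (d.classify i)
      embed-shift : ∀ s → embed (Sum.map₁ suc s) ≡ suc (d.embed s)
      embed-shift (inj₁ _) = refl
      embed-shift (inj₂ _) = refl
      embed-classify : StrictlyInverseˡ _≡_ embed classify
      embed-classify zero    = refl
      embed-classify (suc i) = ≡.trans (embed-shift (d.classify i)) (cong suc (d.embed-classify i))
      classify-embed : StrictlyInverseʳ _≡_ embed classify
      classify-embed (inj₁ zero)    = refl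
      classify-embed (inj₁ (suc i)) = cong (Sum.map₁ suc) (d.classify-embed (inj₁ i))
      classify-embed (inj₂ j)       = cong (Sum.map₁ suc) (d.classify-embed (inj₂ j))
      lookup-embed : ∀ s → lookup (inj₁ a ∷ xs) (embed s) ≡ lookup⊎ (a ∷ as) bs s
      lookup-embed (inj₁ zero)    = refl
      lookup-embed (inj₁ (suc i)) = d.lookup-embed (inj₁ i)
      lookup-embed (inj₂ j)       = d.lookup-embed (inj₂ j)

  consʳ : ∀ {xs as bs} b → Decomposition xs as bs → Decomposition (inj₂ b ∷ xs) as (b ∷ bs)
  consʳ {xs} {as} {bs} b d = record
    { embed = embed ; classify = classify ; embed-classify = embed-classify
    ; classify-embed = classify-embed ; lookup-embed = lookup-embed }
    where
      module d = Decomposition d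
      embed : Pos as (b ∷ bs) → Fin (length (inj₂ b ∷ xs))
      embed (inj₁ i)       = suc (d.embed (inj₁ i))
      embed (inj₂ zero)    = zero
      embed (inj₂ (suc j)) = suc (d.embed (inj₂ j))
      classify : Fin (length (inj₂ b ∷ xs)) → Pos as (b ∷ bs)
      classify zero    = inj₂ zero
      classify (suc i) = Sum.map₂ suc (d.classify i)
      embed-shift : ∀ s → embed (Sum.map₂ suc s) ≡ suc (d.embed s)
      embed-shift (inj₁ _) = refl
      embed-shift (inj₂ _) = refl
      embed-classify : StrictlyInverseˡ _≡_ embed classify
      embed-classify zero    = refl
      embed-classify (suc i) = ≡.trans (embed-shift (d.classify i)) (cong suc (d.embed-classify i))
      classify-embed : StrictlyInverseʳ _≡_ embed classify
      classify-embed (inj₁ i)       = cong (Sum.map₂ suc) (d.classify-embed (inj₁ i))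
      classify-embed (inj₂ zero)    = refl
      classify-embed (inj₂ (suc j)) = cong (Sum.map₂ suc) (d.classify-embed (inj₂ j))
      lookup-embed : ∀ s → lookup (inj₂ b ∷ xs) (embed s) ≡ lookup⊎ as (b ∷ bs) s
      lookup-embed (inj₁ i)       = d.lookup-embed (inj₁ i)
      lookup-embed (inj₂ zero)    = refl
      lookup-embed (inj₂ (suc j)) = d.lookup-embed (inj₂ j)

  decompose : ∀ xs → Decomposition xs (proj₁ (partitionSums xs)) (proj₂ (partitionSums xs))
  decompose []            = []ᴰ
  decompose (inj₁ a ∷ xs) = consˡ a (decompose xs)
  decompose (inj₂ b ∷ xs) = consʳ b (decompose xs)

  concatenate : ∀ as bs → Decomposition (List.map inj₁ as ++ List.map inj₂ bs) as bs
  concatenate (a ∷ as) bs       = consˡ a (concatenate as bs)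
  concatenate []       (b ∷ bs) = consʳ b (concatenate [] bs)
  concatenate []       []       = []ᴰ

  module _ {as bs as′ bs′} (f : SHom k A as as′) (g : SHom k B bs bs′) where

    map⊎ : Pos as′ bs′ → Pos as bs
    map⊎ = Sum.map (map f) (map g)

    comp⊎ : ∀ s → lookup⊎ as bs (map⊎ s) C.⇒ lookup⊎ as′ bs′ s
    comp⊎ (inj₁ i) = comp f i
    comp⊎ (inj₂ j) = comp g j

  inj₁-≋ : ∀ {a b a′ b′} {u : a A.⇒ b} {v : a′ A.⇒ b′} →
           u A≋.≋ v → _≋_ {inj₁ a} {inj₁ b} u {inj₁ a′} {inj₁ b′} v
  inj₁-≋ (A≋.≈⇒≋ p) = ≈⇒≋ p

  inj₁-≋⁻¹ : ∀ {a b a′ b′} {u : a A.⇒ b} {v : a′ A.⇒ b′} →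
             _≋_ {inj₁ a} {inj₁ b} u {inj₁ a′} {inj₁ b′} v → u A≋.≋ v
  inj₁-≋⁻¹ (≈⇒≋ p) = A≋.≈⇒≋ p

  inj₂-≋ : ∀ {a b a′ b′} {u : a B.⇒ b} {v : a′ B.⇒ b′} →
           u B≋.≋ v → _≋_ {inj₂ a} {inj₂ b} u {inj₂ a′} {inj₂ b′} v
  inj₂-≋ (B≋.≈⇒≋ p) = ≈⇒≋ p

  inj₂-≋⁻¹ : ∀ {a b a′ b′} {u : a B.⇒ b} {v : a′ B.⇒ b′} →
             _≋_ {inj₂ a} {inj₂ b} u {inj₂ a′} {inj₂ b′} v → u B≋.≋ v
  inj₂-≋⁻¹ (≈⇒≋ p) = B≋.≈⇒≋ p

  join : ∀ {xs ys as bs as′ bs′} → Decomposition xs as bs → Decomposition ys as′ bs′ →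
         SHom k A as as′ → SHom k B bs bs′ → SHom k C xs ys
  join {xs} {ys} dx dy f g = shom (X.embed ∘′ map⊎ f g ∘′ Y.classify) admissible component
    where
      module X = Decomposition dx
      module Y = Decomposition dy
      admissible : Admissible k (X.embed ∘′ map⊎ f g ∘′ Y.classify)
      admissible = admissible′⇒admissible k
        (admissible′-conjugate k X.embed-bijective Y.classify-bijective
          (admissible′-⊎ k (admissible⇒admissible′ k (adm f)) (admissible⇒admissible′ k (adm g))))
      component : ∀ j → lookup xs (X.embed (map⊎ f g (Y.classify j))) C.⇒ lookup ys j
      component j = conjugate (Y.lookup-classify j) (comp⊎ f g (Y.classify j))
                              (X.lookup-embed (map⊎ f g (Y.classify j)))

  module _ {xs ys as bs as′ bs′} (dx : Decomposition xs as bs) (dy : Decomposition ys as′ bs′) where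
    private
      module X = Decomposition dx
      module Y = Decomposition dy

    ≈-by-embed : {u v : SHom k C xs ys} →
                 (∀ s → map u (Y.embed s) ≡ map v (Y.embed s)
                      × comp u (Y.embed s) ≋ comp v (Y.embed s)) →
                 SEq k C u v
    ≈-by-embed {u} {v} agree = pointwise⇒SEq k C {xs} {ys} {u} {v}
      (Y.elim (λ j → map u j ≡ map v j × comp u j ≋ comp v j) agree)

    module _ (f : SHom k A as as′) (g : SHom k B bs bs′) where

      join-map-embed : ∀ s → map (join dx dy f g) (Y.embed s) ≡ X.embed (map⊎ f g s)
      join-map-embed s = cong (X.embed ∘′ map⊎ f g) (Y.classify-embed s)

      join-comp-embed : ∀ s → comp (join dx dy f g) (Y.embed s)
                                ≋[ lookup⊎ as bs (map⊎ f g s) , lookup⊎ as′ bs′ s ] comp⊎ f g s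
      join-comp-embed s =
        ≋-trans (conjugate-≋ (Y.lookup-classify (Y.embed s)) (comp⊎ f g t)
                             (X.lookup-embed (map⊎ f g t)))
                (≋-cong {F = lookup⊎ as bs ∘′ map⊎ f g} {G = lookup⊎ as′ bs′} (comp⊎ f g)
                        (Y.classify-embed s))
        where t = Y.classify (Y.embed s)

      join-unique : {u : SHom k C xs ys} →
                    (∀ s → map u (Y.embed s) ≡ X.embed (map⊎ f g s)
                         × comp u (Y.embed s)
                             ≋[ lookup⊎ as bs (map⊎ f g s) , lookup⊎ as′ bs′ s ] comp⊎ f g s) →
                    SEq k C (join dx dy f g) u
      join-unique {u} agree = ≈-by-embed {join dx dy f g} {u} λ s →
          ≡.trans (join-map-embed s) (≡.sym (proj₁ (agree s)))
        , ≋-trans (join-comp-embed s) (≋-sym (proj₂ (agree s)))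

    join-resp : ∀ {f f′ g g′} → SEq k A f f′ → SEq k B g g′ →
                SEq k C (join dx dy f g) (join dx dy f′ g′)
    join-resp {f} {f′} {g} {g′} f≈f′ g≈g′ = join-unique f g {join dx dy f′ g′} λ where
        s@(inj₁ i) → ≡.trans (join-map-embed f′ g′ s)
                             (cong (X.embed ∘′ inj₁) (≡.sym (proj₁ (f≈f′ i))))
                   , ≋-trans (join-comp-embed f′ g′ s)
                             (≋-sym (inj₁-≋ (SEq⇒≋ k A {f = f} {f′} f≈f′ i)))
        s@(inj₂ j) → ≡.trans (join-map-embed f′ g′ s)
                             (cong (X.embed ∘′ inj₂) (≡.sym (proj₁ (g≈g′ j))))
                   , ≋-trans (join-comp-embed f′ g′ s)
                             (≋-sym (inj₂-≋ (SEq⇒≋ k B {f = g} {g′} g≈g′ j)))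

    join-faithful : ∀ {f f′ g g′} → SEq k C (join dx dy f g) (join dx dy f′ g′) →
                    SEq k A f f′ × SEq k B g g′
    join-faithful {f} {f′} {g} {g′} eq =
        pointwise⇒SEq k A {f = f} {f′}
          (λ i → inj₁-injective (map-eq (inj₁ i)) , inj₁-≋⁻¹ (comp-eq (inj₁ i)))
      , pointwise⇒SEq k B {f = g} {g′}
          (λ j → inj₂-injective (map-eq (inj₂ j)) , inj₂-≋⁻¹ (comp-eq (inj₂ j)))
      where
        map-eq : ∀ s → map⊎ f g s ≡ map⊎ f′ g′ s
        map-eq s = X.embed-injective (≡.trans (≡.sym (join-map-embed f g s))
                                              (≡.trans (proj₁ (eq (Y.embed s))) (join-map-embed f′ g′ s)))
        comp-eq : ∀ s → comp⊎ f g s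
                          ≋[ lookup⊎ as bs (map⊎ f′ g′ s) , lookup⊎ as′ bs′ s ] comp⊎ f′ g′ s
        comp-eq s = ≋-trans (≋-sym (join-comp-embed f g s))
                            (≋-trans (SEq⇒≋ k C {f = join dx dy f g} {join dx dy f′ g′} eq (Y.embed s))
                                     (join-comp-embed f′ g′ s))

  join-∘ : ∀ {xs ys zs as bs as′ bs′ as″ bs″} (dx : Decomposition xs as bs)
             (dy : Decomposition ys as′ bs′) (dz : Decomposition zs as″ bs″)
             (f : SHom k A as as′) (g : SHom k B bs bs′)
             (f′ : SHom k A as′ as″) (g′ : SHom k B bs′ bs″) →
           SEq k C (join dx dz (f′ SA.∘ f) (g′ SB.∘ g)) (join dy dz f′ g′ SC.∘ join dx dy f g)
  join-∘ {xs} {ys} {zs} {as} {bs} {as′} {bs′} {as″} {bs″} dx dy dz f g f′ g′ =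
    join-unique dx dz (f′ SA.∘ f) (g′ SB.∘ g) {join′ SC.∘ join₀} λ where
      s@(inj₁ _) → map-agrees s , comp-agrees s
      s@(inj₂ _) → map-agrees s , comp-agrees s
    where
      module X = Decomposition dx
      module Z = Decomposition dz
      join₀ = join dx dy f g
      join′ = join dy dz f′ g′
      map-agrees : ∀ s → map (join′ SC.∘ join₀) (Z.embed s) ≡ X.embed (map⊎ f g (map⊎ f′ g′ s))
      map-agrees s = ≡.trans (cong (map join₀) (join-map-embed dy dz f′ g′ s))
                             (join-map-embed dx dy f g (map⊎ f′ g′ s))
      comp-agrees : ∀ s → comp (join′ SC.∘ join₀) (Z.embed s)
                            ≋[ lookup⊎ as bs (map⊎ f g (map⊎ f′ g′ s)) , lookup⊎ as″ bs″ s ]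
                          C._∘_ {lookup⊎ as bs (map⊎ f g (map⊎ f′ g′ s))}
                                {lookup⊎ as′ bs′ (map⊎ f′ g′ s)} {lookup⊎ as″ bs″ s}
                                (comp⊎ f′ g′ s) (comp⊎ f g (map⊎ f′ g′ s))
      comp-agrees s =
        ∘-resp-≋ (join-comp-embed dy dz f′ g′ s)
                 (≋-trans (≋-cong {F = lookup xs ∘′ map join₀} {G = lookup ys} (comp join₀)
                                  (join-map-embed dy dz f′ g′ s))
                          (join-comp-embed dx dy f g (map⊎ f′ g′ s)))

  join-id : ∀ {xs as bs} (dx : Decomposition xs as bs) → SEq k C (join dx dx SA.id SB.id) SC.id
  join-id dx = join-unique dx dx SA.id SB.id {SC.id} λ where
      s@(inj₁ _) → refl , id-≋ (X.lookup-embed s)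
      s@(inj₂ _) → refl , id-≋ (X.lookup-embed s)
    where module X = Decomposition dx

  left-source : ∀ {as bs a} t → lookup⊎ as bs t C.⇒ inj₁ a →
                Σ (Fin (length as)) λ i → inj₁ i ≡ t
  left-source (inj₁ i) _ = i , refl
  left-source (inj₂ _) (lift ())

  right-source : ∀ {as bs b} t → lookup⊎ as bs t C.⇒ inj₂ b →
                 Σ (Fin (length bs)) λ j → inj₂ j ≡ t
  right-source (inj₁ _) (lift ())
  right-source (inj₂ j) _ = j , refl

  module Split {xs ys as bs as′ bs′} (dx : Decomposition xs as bs) (dy : Decomposition ys as′ bs′)
               (h : SHom k C xs ys) where
    private
      module X = Decomposition dx
      module Y = Decomposition dy

    reindex : Pos as′ bs′ → Pos as bs
    reindex s = X.classify (map h (Y.embed s))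

    component : ∀ s → lookup⊎ as bs (reindex s) C.⇒ lookup⊎ as′ bs′ s
    component s = conjugate (Y.lookup-embed s) (comp h (Y.embed s)) (X.lookup-classify (map h (Y.embed s)))

    component-≋ : ∀ s → comp h (Y.embed s)
                          ≋[ lookup⊎ as bs (reindex s) , lookup⊎ as′ bs′ s ] component s
    component-≋ s = ≋-sym (conjugate-≋ (Y.lookup-embed s) (comp h (Y.embed s))
                                       (X.lookup-classify (map h (Y.embed s))))

    private
      sourceˡ : ∀ j → Σ (Fin (length as)) λ i → inj₁ i ≡ reindex (inj₁ j)
      sourceˡ j = left-source {as} {bs} {lookup as′ j} (reindex (inj₁ j)) (component (inj₁ j))

      sourceʳ : ∀ j → Σ (Fin (length bs)) λ i → inj₂ i ≡ reindex (inj₂ j)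
      sourceʳ j = right-source {as} {bs} {lookup bs′ j} (reindex (inj₂ j)) (component (inj₂ j))

    mapˡ : Fin (length as′) → Fin (length as)
    mapˡ j = proj₁ (sourceˡ j)

    mapʳ : Fin (length bs′) → Fin (length bs)
    mapʳ j = proj₁ (sourceʳ j)

    Sum-map≡reindex : ∀ s → Sum.map mapˡ mapʳ s ≡ reindex s
    Sum-map≡reindex (inj₁ j) = proj₂ (sourceˡ j)
    Sum-map≡reindex (inj₂ j) = proj₂ (sourceʳ j)

    reindexed : ∀ s → lookup⊎ as bs (Sum.map mapˡ mapʳ s) ≡ lookup⊎ as bs (reindex s)
    reindexed s = cong (lookup⊎ as bs) (Sum-map≡reindex s)

    compˡ : ∀ j → lookup as (mapˡ j) A.⇒ lookup as′ j
    compˡ j = C._∘_ {inj₁ (lookup as (mapˡ j))} {lookup⊎ as bs (reindex (inj₁ j))}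
                    {inj₁ (lookup as′ j)} (component (inj₁ j)) (transport (reindexed (inj₁ j)))

    compʳ : ∀ j → lookup bs (mapʳ j) B.⇒ lookup bs′ j
    compʳ j = C._∘_ {inj₂ (lookup bs (mapʳ j))} {lookup⊎ as bs (reindex (inj₂ j))}
                    {inj₂ (lookup bs′ j)} (component (inj₂ j)) (transport (reindexed (inj₂ j)))

    admissible-sides : Admissible′ k mapˡ × Admissible′ k mapʳ
    admissible-sides = admissible′-⊎⁻ k (admissible′-resp-≗ k (λ s → ≡.sym (Sum-map≡reindex s))
      (admissible′-conjugate k X.classify-bijective Y.embed-bijective
                             (admissible⇒admissible′ k (adm h))))

    splitˡ : SHom k A as as′
    splitˡ = shom mapˡ (admissible′⇒admissible k (proj₁ admissible-sides)) compˡ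

    splitʳ : SHom k B bs bs′
    splitʳ = shom mapʳ (admissible′⇒admissible k (proj₂ admissible-sides)) compʳ

    join-split : SEq k C (join dx dy splitˡ splitʳ) h
    join-split = join-unique dx dy splitˡ splitʳ {h} λ where
        s@(inj₁ _) → map-agrees s
                   , ≋-trans (component-≋ s) (≋-sym (∘-transport-≋ (component s) (reindexed s)))
        s@(inj₂ _) → map-agrees s
                   , ≋-trans (component-≋ s) (≋-sym (∘-transport-≋ (component s) (reindexed s)))
      where
        map-agrees : ∀ s → map h (Y.embed s) ≡ X.embed (Sum.map mapˡ mapʳ s)
        map-agrees s = ≡.sym (≡.trans (cong X.embed (Sum-map≡reindex s))
                                      (X.embed-classify (map h (Y.embed s))))

  anafunctor : FullyFaithfulAnafunctor (S k A ×C S k B) (S k C) o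
  anafunctor = record
    { Spec         = λ (as , bs) xs → Decomposition xs as bs
    ; specify      = λ xs → partitionSums xs , decompose xs
    ; realise      = λ (as , bs) → List.map inj₁ as ++ List.map inj₂ bs , concatenate as bs
    ; F₁           = λ dx dy (f , g) → join dx dy f g
    ; F-resp-≈     = λ dx dy (f≈f′ , g≈g′) → join-resp dx dy f≈f′ g≈g′
    ; identity     = join-id
    ; homomorphism = λ dx dy dz {p} {q} → join-∘ dx dy dz (proj₁ p) (proj₂ p) (proj₁ q) (proj₂ q)
    ; faithful     = λ dx dy → join-faithful dx dy
    ; full         = λ dx dy h → (Split.splitˡ dx dy h , Split.splitʳ dx dy h)
                                , Split.join-split dx dy h
    }

proposition2 : (k : Kind) → ∀ {o ℓ e} (A B : Category o ℓ e) →
    Equivalence (S k (A ⊔C B)) (S k A ×C S k B)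
proposition2 k A B = FullyFaithfulAnafunctor⇒Equivalence (Coproduct.anafunctor k A B)
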